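{- Every graph $C_n^2$ with $n\geq 5$ is a 4-connected $Oct_{2}^{+}$-free graph.
   Context: $C_{n}^{2}$ is the square of the $n$-cycle: vertex set $\mathbb{Z}_n$, $i\sim j$ iff $i-j\in\{\pm1,\pm2\}\pmod n$. $H$ is a minor of $G$ if $H$ can be obtained from $G$ by deleting vertices/edges and contracting edges; $G$ is $H$-free if it has no minor isomorphic to $H$. $Oct$ is the octahedron $K_{2,2,2}$. Pick a vertex $v$ of $Oct$; its neighbours induce a 4-cycle $abcda$. $Oct_{2}^{+}$ is obtained from $Oct$ by deleting $v$ and adding two new adjacent vertices $v',v''$ with $v'$ joined to $a,c$ and $v''$ joined to $b,d$. -}

module Defs where

open import Data.Nat using (ℕ; zero; suc; _+_; _∸_; _≤_; _<_; _%_; NonZero)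
open import Data.Fin using (Fin; toℕ; #_)
open import Data.List using (List; length)
open import Data.List.Membership.Propositional using (_∈_)
open import Data.Product using (Σ; ∃; _×_)
open import Data.Sum using (_⊎_)
open import Relation.Nullary using (¬_)
open import Relation.Binary.PropositionalEquality using (_≡_)

record Graph : Set₁ where
  field
    size : ℕ
    Adj  : Fin size → Fin size → Set
open Graph public

data Walk (G : Graph) (P : Fin (size G) → Set) : Fin (size G) → Fin (size G) → Set where
  here : ∀ {x} → P x → Walk G P x x
  step : ∀ {x y z} → P x → Adj G x y → Walk G P y z → Walk G P x z

ConnectedOn : (G : Graph) → (Fin (size G) → Set) → Set
ConnectedOn G P = ∀ x y → P x → P y → Walk G P x y

-- G is k-connected: |G| > k and G - X is connected for every X with |X| < k.
-- X is given as a list of vertices of length < k (repetitions allowed).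
KConnected : ℕ → Graph → Set
KConnected k G =
  (k < size G) ×
  ((X : List (Fin (size G))) → length X < k →
     ConnectedOn G (λ v → ¬ (v ∈ X)))

record MinorModel (H G : Graph) : Set₁ where
  field
    Branch    : Fin (size H) → Fin (size G) → Set
    nonempty  : ∀ h → ∃ λ g → Branch h g
    disjoint  : ∀ {h h' g} → Branch h g → Branch h' g → h ≡ h'
    connected : ∀ h → ConnectedOn G (Branch h)
    edges     : ∀ {h h'} → Adj H h h' →
                Σ (Fin (size G)) λ g → Σ (Fin (size G)) λ g' →
                  Branch h g × Branch h' g' × Adj G g g'

IsMinor : Graph → Graph → Set₁
IsMinor H G = MinorModel H G

Free : Graph → Graph → Set₁
Free H G = ¬ IsMinor H G

C2-adj : (n : ℕ) → Fin n → Fin n → Set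
C2-adj zero ()
C2-adj (suc m) i j =
  ((toℕ i + 1) % suc m ≡ toℕ j) ⊎ ((toℕ i + 2) % suc m ≡ toℕ j) ⊎
  ((toℕ j + 1) % suc m ≡ toℕ i) ⊎ ((toℕ j + 2) % suc m ≡ toℕ i)

Csq : ℕ → Graph
Csq n = record { size = n ; Adj = C2-adj n }

-- Oct_2^+ on 7 vertices:
--   0 = w (the vertex of Oct opposite the deleted v), 1 = a, 2 = b, 3 = c, 4 = d,
--   5 = v' , 6 = v''.
data OctE : Fin 7 → Fin 7 → Set where
  wa : OctE (# 0) (# 1)
  wb : OctE (# 0) (# 2)
  wc : OctE (# 0) (# 3)
  wd : OctE (# 0) (# 4)
  ab : OctE (# 1) (# 2)
  bc : OctE (# 2) (# 3)
  cd : OctE (# 3) (# 4)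
  da : OctE (# 4) (# 1)
  v'v'' : OctE (# 5) (# 6)
  v'a : OctE (# 5) (# 1)
  v'c : OctE (# 5) (# 3)
  v''b : OctE (# 6) (# 2)
  v''d : OctE (# 6) (# 4)

OctAdj : Fin 7 → Fin 7 → Set
OctAdj x y = OctE x y ⊎ OctE y x

Oct2+ : Graph
Oct2+ = record { size = 7 ; Adj = OctAdj }

{-# OPTIONS --safe #-}
module Submission where

-- 4-connectivity: cut the cycle open at x and walk forward 0, 1, 2, … by steps of
-- one or two; the walk can only get stuck at two consecutive deleted vertices.  If
-- both arcs between x and y are blocked, the deleted set contains two disjoint
-- consecutive pairs, so it has at least four vertices.
--
-- Oct₂⁺-freeness: deleting w from Oct₂⁺ leaves K₃,₃.  Cut the cycle open at a vertex
-- of the branch set of w and discard the branch set (if any) containing the next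
-- vertex: the other five branch sets form a K₂,₃-model in the square of the path
-- 2, 3, …, n − 1, which is impossible.  Indeed, let p be the least of the maxima of
-- the five branch sets, attained by X.  Every other branch set reaches beyond p, so
-- one adjacent to X contains p + 1 or p + 2.  If X is a hub (on the side of size
-- two), the three legs would have to share these two vertices.  If X is a leg, the two hubs occupy p + 1 and
-- p + 2 and the other two legs lie beyond p + 2; if r is the smaller of their minima,
-- both hubs must pass through r − 1 to reach the leg lying beyond r.

open import Defs
open import Data.Nat using (ℕ; _≤_)
open import Data.Product using (_×_)

open import Data.Empty using (⊥; ⊥-elim)
open import Data.Fin as Fin using (Fin; toℕ; fromℕ<; punchIn)
open import Data.Fin.Patterns using (0F; 1F; 2F; 3F; 4F; 5F; 6F)
open import Data.Fin.Properties
  using (toℕ-injective; toℕ-fromℕ<; toℕ<n; punchIn-injective; punchInᵢ≢i; any?)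
open import Data.List using (List; []; _∷_; _++_; length; map; tabulate)
open import Data.List.Extrema.Nat
  using (max; min; argmin; argmin-sel; argmax-sel; ⊥≤max; xs≤max; min≤⊤; min≤xs; f[argmin]≤f[xs])
open import Data.List.Membership.Propositional using (_∈_; _∉_)
open import Data.List.Membership.Propositional.Properties
  using (∈-map⁺; ∈-map⁻; ∈-++⁺ˡ; ∈-++⁺ʳ; ∈-++⁻; ∈-∃++; ∈-tabulate⁺)
open import Data.List.Properties using (length-++; length-map)
open import Data.List.Relation.Binary.Disjoint.Propositional using (Disjoint)
open import Data.List.Relation.Unary.All as All using (All; []; _∷_)
open import Data.List.Relation.Unary.All.Properties using (tabulate⁺)
open import Data.List.Relation.Unary.AllPairs as AllPairs using ([]; _∷_)
open import Data.List.Relation.Unary.Any using (here; there)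
open import Data.List.Relation.Unary.Linked using (Linked; []; [-]; _∷_)
open import Data.List.Relation.Unary.Linked.Properties using (Linked⇒AllPairs)
open import Data.List.Relation.Unary.Unique.Propositional using (Unique)
open import Data.Maybe using (Maybe; just; nothing)
open import Data.Maybe.Properties using (just-injective)
open import Data.Nat using (zero; suc; _+_; _∸_; _<_; _%_; z≤n; s≤s; _<?_; NonZero)
open import Data.Nat.DivMod
  using (m%n<n; m%n≤m; m<n⇒m%n≡m; [m+n]%n≡m%n; %-distribˡ-+; m%n%n≡m%n; m≤n⇒[n∸m]%m≡n%m)
open import Data.Nat.Properties
open import Data.Product using (Σ; ∃; ∃₂; _,_; proj₁; proj₂; swap; uncurry)
open import Data.Sum as Sum using (_⊎_; inj₁; inj₂)
open import Data.Sum.Properties using (inj₁-injective; inj₂-injective; swap-involutive)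
open import Function using (_∘_; id; case_of_)
open import Relation.Binary.PropositionalEquality
open import Relation.Binary.Definitions using (DecidableEquality; tri<; tri≈; tri>)
open import Relation.Nullary using (¬_; Dec; yes; no)

unique⊆⇒length≤ : ∀ {A : Set} {ys xs : List A} → Unique ys → All (_∈ xs) ys → length ys ≤ length xs
unique⊆⇒length≤ {ys = []} _ _ = z≤n
unique⊆⇒length≤ {ys = y ∷ ys} (y≢ys ∷ unique) (y∈xs ∷ ys⊆xs) with ∈-∃++ y∈xs
... | as , bs , refl =
  ≤-trans (s≤s (unique⊆⇒length≤ unique (All.zipWith (uncurry remove) (y≢ys , ys⊆xs))))
          (≤-reflexive (sym length-insert))
  where
    remove : ∀ {z} → y ≢ z → z ∈ as ++ y ∷ bs → z ∈ as ++ bs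
    remove y≢z z∈ with ∈-++⁻ as z∈
    ... | inj₁ z∈as = ∈-++⁺ˡ z∈as
    ... | inj₂ (here refl) = ⊥-elim (y≢z refl)
    ... | inj₂ (there z∈bs) = ∈-++⁺ʳ as z∈bs
    length-insert : length (as ++ y ∷ bs) ≡ suc (length (as ++ bs))
    length-insert = begin
      length (as ++ y ∷ bs)          ≡⟨ length-++ as ⟩
      length as + suc (length bs)    ≡⟨ +-suc (length as) (length bs) ⟩
      suc (length as + length bs)    ≡⟨ cong suc (length-++ as) ⟨
      suc (length (as ++ bs))        ∎
      where open ≡-Reasoning

Linked-map : ∀ {A B : Set} {P : A → Set} {R : A → A → Set} {S : B → B → Set} (f : A → B) →
             (∀ {x y} → P x → P y → R x y → S (f x) (f y)) →
             ∀ {xs} → All P xs → Linked R xs → Linked S (map f xs)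
Linked-map f pres _ [] = []
Linked-map f pres _ [-] = [-]
Linked-map f pres (px ∷ pys@(py ∷ _)) (_∷_ {x} {y} r rs) = pres {x} {y} px py r ∷ Linked-map f pres pys rs

greatest : ∀ {x xs} → x ∈ xs → ∃ λ m → m ∈ xs × All (_≤ m) xs
greatest {xs = y ∷ ys} _ = max y ys , Sum.[ here , there ]′ (argmax-sel id y ys) , ⊥≤max y ys ∷ xs≤max y ys

least : ∀ {x xs} → x ∈ xs → ∃ λ m → m ∈ xs × All (m ≤_) xs
least {xs = y ∷ ys} _ = min y ys , Sum.[ here , there ]′ (argmin-sel id y ys) , min≤⊤ y ys ∷ min≤xs y ys

module _ {G : Graph} {P : Fin (size G) → Set} where

  private
    variable
      x y z : Fin (size G)

  _++ʷ_ : Walk G P x y → Walk G P y z → Walk G P x z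
  here _ ++ʷ w′ = w′
  step px a w ++ʷ w′ = step px a (w ++ʷ w′)

  start-holds : Walk G P x y → P x
  start-holds (here px) = px
  start-holds (step px _ _) = px

  reverse : (∀ {u v} → Adj G u v → Adj G v u) → Walk G P x y → Walk G P y x
  reverse sym (here px) = here px
  reverse sym (step px a w) = reverse sym w ++ʷ step (start-holds w) (sym a) (here px)

  vertices : Walk G P x y → List (Fin (size G))
  vertices (here {x} _) = x ∷ []
  vertices (step {x} _ _ w) = x ∷ vertices w

  vertices-linked : (w : Walk G P x y) → Linked (Adj G) (vertices w)
  vertices-linked (here _) = [-]
  vertices-linked (step _ a (here _)) = a ∷ [-]
  vertices-linked (step _ a w@(step _ _ _)) = a ∷ vertices-linked w

  vertices-hold : (w : Walk G P x y) → All P (vertices w)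
  vertices-hold (here px) = px ∷ []
  vertices-hold (step px _ w) = px ∷ vertices-hold w

  start∈vertices : (w : Walk G P x y) → x ∈ vertices w
  start∈vertices (here _) = here refl
  start∈vertices (step _ _ _) = here refl

  ∈-vertices-++ʷ⁺ʳ : ∀ {v} (w : Walk G P x y) {w′ : Walk G P y z} →
                     v ∈ vertices w′ → v ∈ vertices (w ++ʷ w′)
  ∈-vertices-++ʷ⁺ʳ (here _) x∈ = x∈
  ∈-vertices-++ʷ⁺ʳ (step _ _ w) x∈ = there (∈-vertices-++ʷ⁺ʳ w x∈)

  tour : ConnectedOn G P → P x → ∀ {ys} → All P ys →
         ∃ λ z → Σ (Walk G P x z) λ w → All (_∈ vertices w) ys
  tour conn px [] = _ , here px , []
  tour conn px (py ∷ pys) with tour conn py pys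
  ... | _ , w , ys∈w = _ , conn _ _ px py ++ʷ w ,
                       ∈-vertices-++ʷ⁺ʳ (conn _ _ px py) (start∈vertices w) ∷
                       All.map (∈-vertices-++ʷ⁺ʳ (conn _ _ px py)) ys∈w

  record Cover (xs : List (Fin (size G))) : Set where
    field
      walkList : List (Fin (size G))
      linked   : Linked (Adj G) walkList
      holds    : All P walkList
      covers   : All (_∈ walkList) xs

  cover : ConnectedOn G P → ∀ {xs} → All P xs → Cover xs
  cover conn [] = record { walkList = [] ; linked = [] ; holds = [] ; covers = [] }
  cover conn (px ∷ pxs) with tour conn px pxs
  ... | _ , w , xs∈w = record
    { walkList = vertices w ; linked = vertices-linked w ; holds = vertices-hold w
    ; covers = start∈vertices w ∷ xs∈w }

Touching : {A : Set} → (A → A → Set) → List A → List A → Set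
Touching _~_ xs ys = ∃₂ λ x y → x ∈ xs × y ∈ ys × x ~ y

Touching-sym : {A : Set} {_~_ : A → A → Set} → (∀ {x y} → x ~ y → y ~ x) →
               ∀ {xs ys} → Touching _~_ xs ys → Touching _~_ ys xs
Touching-sym sym (x , y , x∈ , y∈ , x~y) = y , x , y∈ , x∈ , sym x~y

-- A minor model of (V, E) in (A, ~) whose branch sets are walks: lists in which
-- consecutive entries are adjacent.
record ListModel {V A : Set} (E : V → V → Set) (_~_ : A → A → Set) : Set where
  field
    part      : V → List A
    connected : ∀ v → Linked _~_ (part v)
    disjoint  : ∀ {u v} → u ≢ v → Disjoint (part u) (part v)
    touching  : ∀ {u v} → E u v → Touching _~_ (part u) (part v)

  ∉-other : ∀ {u v x} → x ∈ part u → u ≢ v → x ∉ part v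
  ∉-other x∈u u≢v x∈v = disjoint u≢v (x∈u , x∈v)

data Biclique (s t : ℕ) : Fin s ⊎ Fin t → Fin s ⊎ Fin t → Set where
  edge : ∀ i j → Biclique s t (inj₁ i) (inj₂ j)

module _ {A : Set} {_~_ : A → A → Set} where

  open ListModel

  transpose : ∀ {s t} → (∀ {x y} → x ~ y → y ~ x) →
              ListModel (Biclique s t) _~_ → ListModel (Biclique t s) _~_
  transpose ~-sym M = record
    { part      = part M ∘ Sum.swap
    ; connected = connected M ∘ Sum.swap
    ; disjoint  = λ {u} {v} u≢v → disjoint M (u≢v ∘ swap-injective u v)
    ; touching  = λ { (edge j i) → Touching-sym ~-sym (touching M (edge i j)) }
    }
    where
      swap-injective : ∀ u v → Sum.swap u ≡ Sum.swap v → u ≡ v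
      swap-injective u v eq = trans (sym (swap-involutive u)) (trans (cong Sum.swap eq) (swap-involutive v))

  deleteHub : ∀ {s t} → Fin (suc s) → ListModel (Biclique (suc s) t) _~_ → ListModel (Biclique s t) _~_
  deleteHub i M = record
    { part      = part M ∘ Sum.map₁ (punchIn i)
    ; connected = connected M ∘ Sum.map₁ (punchIn i)
    ; disjoint  = λ {u} {v} u≢v → disjoint M (u≢v ∘ punchIn-map₁-injective u v)
    ; touching  = λ { (edge k j) → touching M (edge (punchIn i k) j) }
    }
    where
      punchIn-map₁-injective : ∀ {t} (u v : Fin _ ⊎ Fin t) →
                               Sum.map₁ (punchIn i) u ≡ Sum.map₁ (punchIn i) v → u ≡ v
      punchIn-map₁-injective (inj₁ k) (inj₁ l) eq = cong inj₁ (punchIn-injective i k l (inj₁-injective eq))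
      punchIn-map₁-injective (inj₂ j) (inj₂ l) eq = cong inj₂ (inj₂-injective eq)

  module _ {s : ℕ} (~-sym : ∀ {x y} → x ~ y → y ~ x) where

    deletePart : Fin (suc s) ⊎ Fin (suc s) →
                 ListModel (Biclique (suc s) (suc s)) _~_ → ListModel (Biclique s (suc s)) _~_
    deletePart (inj₁ i) M = deleteHub i M
    deletePart (inj₂ j) M = deleteHub j (transpose ~-sym M)

    deletePart-All : ∀ {Q : A → Set} u M → (∀ w → w ≢ u → All Q (part M w)) →
                     ∀ v → All Q (part (deletePart u M) v)
    deletePart-All (inj₁ i) M others (inj₁ k) =
      others (inj₁ (punchIn i k)) (punchInᵢ≢i i k ∘ inj₁-injective)
    deletePart-All (inj₁ i) M others (inj₂ j) = others (inj₂ j) λ ()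
    deletePart-All (inj₂ j) M others (inj₁ k) =
      others (inj₂ (punchIn j k)) (punchInᵢ≢i j k ∘ inj₂-injective)
    deletePart-All (inj₂ j) M others (inj₂ l) = others (inj₁ l) λ ()

  all-but-one-miss : ∀ {s t} → DecidableEquality A → (c : A) → (M : ListModel (Biclique (suc s) t) _~_) →
                     ∃ λ u → ∀ v → v ≢ u → c ∉ part M v
  all-but-one-miss _≟_ c M with any? (λ i → c ∈? part M (inj₁ i)) | any? (λ j → c ∈? part M (inj₂ j))
    where open import Data.List.Membership.DecPropositional _≟_ using (_∈?_)
  ... | yes (i , c∈) | _ = inj₁ i , λ v v≢u → ∉-other M c∈ (v≢u ∘ sym)
  ... | no _ | yes (j , c∈) = inj₂ j , λ v v≢u → ∉-other M c∈ (v≢u ∘ sym)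
  ... | no c∉hubs | no c∉legs = inj₁ Fin.zero , λ where
    (inj₁ i) _ c∈ → c∉hubs (i , c∈)
    (inj₂ j) _ c∈ → c∉legs (j , c∈)

  mapModel : ∀ {V B : Set} {E : V → V → Set} {_≈_ : B → B → Set} {P : A → Set} (f : A → B) →
             (∀ {x y} → f x ≡ f y → x ≡ y) → (∀ {x y} → P x → P y → x ~ y → f x ≈ f y) →
             (M : ListModel E _~_) → (∀ v → All P (part M v)) → ListModel E _≈_
  mapModel f f-injective pres M parts-hold = record
    { part      = map f ∘ part M
    ; connected = λ v → Linked-map f pres (parts-hold v) (connected M v)
    ; disjoint  = λ u≢v (z∈u , z∈v) → disjoint-images u≢v (∈-map⁻ f z∈u) (∈-map⁻ f z∈v)
    ; touching  = λ { E-uv → let (x , y , x∈ , y∈ , x~y) = touching M E-uv in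
                      f x , f y , ∈-map⁺ f x∈ , ∈-map⁺ f y∈ ,
                      pres {x} {y} (All.lookup (parts-hold _) x∈) (All.lookup (parts-hold _) y∈) x~y }
    }
    where
      disjoint-images : ∀ {u v z} → u ≢ v → ∃ (λ x → x ∈ part M u × z ≡ f x) →
                        ∃ (λ y → y ∈ part M v × z ≡ f y) → ⊥
      disjoint-images u≢v (x , x∈ , refl) (y , y∈ , fx≡fy) =
        ∉-other M x∈ u≢v (subst (_∈ _) (sym (f-injective fx≡fy)) y∈)

module _ {H G : Graph} (M : MinorModel H G) {s t : ℕ} (f : Fin s ⊎ Fin t → Fin (size H))
         (f-injective : ∀ {u v} → f u ≡ f v → u ≡ v)
         (f-edge : ∀ i j → Adj H (f (inj₁ i)) (f (inj₂ j))) where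

  open MinorModel M

  private
    hubEnd : Fin s → Fin t → Fin (size G)
    hubEnd i j = proj₁ (edges (f-edge i j))

    legEnd : Fin s → Fin t → Fin (size G)
    legEnd i j = proj₁ (proj₂ (edges (f-edge i j)))

    hubEnd-in-branch : ∀ i j → Branch (f (inj₁ i)) (hubEnd i j)
    hubEnd-in-branch i j = proj₁ (proj₂ (proj₂ (edges (f-edge i j))))

    legEnd-in-branch : ∀ i j → Branch (f (inj₂ j)) (legEnd i j)
    legEnd-in-branch i j = proj₁ (proj₂ (proj₂ (proj₂ (edges (f-edge i j)))))

    ends-adjacent : ∀ i j → Adj G (hubEnd i j) (legEnd i j)
    ends-adjacent i j = proj₂ (proj₂ (proj₂ (proj₂ (edges (f-edge i j)))))

    ends : Fin s ⊎ Fin t → List (Fin (size G))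
    ends (inj₁ i) = tabulate (hubEnd i)
    ends (inj₂ j) = tabulate (λ i → legEnd i j)

    ends-in-branch : ∀ u → All (Branch (f u)) (ends u)
    ends-in-branch (inj₁ i) = tabulate⁺ (hubEnd-in-branch i)
    ends-in-branch (inj₂ j) = tabulate⁺ λ i → legEnd-in-branch i j

    cover-ends : ∀ u → Cover (ends u)
    cover-ends u = cover (connected (f u)) (ends-in-branch u)

  open Cover

  bicliqueModel : ListModel (Biclique s t) (Adj G)
  bicliqueModel = record
    { part      = walkList ∘ cover-ends
    ; connected = linked ∘ cover-ends
    ; disjoint  = λ u≢v (x∈u , x∈v) → u≢v (f-injective
        (disjoint (All.lookup (holds (cover-ends _)) x∈u) (All.lookup (holds (cover-ends _)) x∈v)))
    ; touching  = λ { (edge i j) →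
        hubEnd i j , legEnd i j ,
        All.lookup (covers (cover-ends (inj₁ i))) (∈-tabulate⁺ j) ,
        All.lookup (covers (cover-ends (inj₂ j))) (∈-tabulate⁺ i) ,
        ends-adjacent i j }
    }

  bicliqueModel-in-branch : ∀ u → All (Branch (f u)) (ListModel.part bicliqueModel u)
  bicliqueModel-in-branch = holds ∘ cover-ends

-- Adjacency in the square of the path 0 – 1 – 2 – ⋯, made reflexive.
Near : ℕ → ℕ → Set
Near x y = x ≤ 2 + y × y ≤ 2 + x

Near-sym : ∀ {x y} → Near x y → Near y x
Near-sym = swap

record Crossing (r : ℕ) (xs : List ℕ) : Set where
  constructor crossing
  field
    {lo hi} : ℕ
    lo∈     : lo ∈ xs
    hi∈     : hi ∈ xs
    lo≤r    : lo ≤ r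
    r<hi    : r < hi
    near    : Near lo hi

Crossing-there : ∀ {r x xs} → Crossing r xs → Crossing r (x ∷ xs)
Crossing-there (crossing lo∈ hi∈ lo≤r r<hi near) = crossing (there lo∈) (there hi∈) lo≤r r<hi near

crosses : ∀ {xs a b r} → Linked Near xs → a ∈ xs → b ∈ xs → a ≤ r → r < b → Crossing r xs
crosses [-] (here refl) (here refl) a≤r r<b = ⊥-elim (≤⇒≯ a≤r r<b)
crosses (_ ∷ _) (here refl) (here refl) a≤r r<b = ⊥-elim (≤⇒≯ a≤r r<b)
crosses (_ ∷ l) (there a∈) (there b∈) a≤r r<b = Crossing-there (crosses l a∈ b∈ a≤r r<b)
crosses {r = r} (_∷_ {y = y} x~y l) (here refl) (there b∈) a≤r r<b with r <? y
... | yes r<y = crossing (here refl) (there (here refl)) a≤r r<y x~y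
... | no r≮y = Crossing-there (crosses l (here refl) b∈ (≮⇒≥ r≮y) r<b)
crosses {r = r} (_∷_ {y = y} x~y l) (there a∈) (here refl) a≤r r<b with r <? y
... | yes r<y = Crossing-there (crosses l a∈ (here refl) a≤r r<y)
... | no r≮y = crossing (there (here refl)) (here refl) (≮⇒≥ r≮y) r<b (Near-sym x~y)

jumps-over : ∀ {xs a b r} → Linked Near xs → suc r ∉ xs → a ∈ xs → b ∈ xs → a ≤ r → suc r < b →
             r ∈ xs × 2 + r ∈ xs
jumps-over {xs} {r = r} l r+1∉ a∈ b∈ a≤r r+1<b with crosses l a∈ b∈ a≤r (<-trans (n<1+n r) r+1<b)
... | crossing {lo} {hi} lo∈ hi∈ lo≤r r<hi (_ , hi≤2+lo) =
  subst (_∈ xs) lo≡r lo∈ , subst (_∈ xs) hi≡2+r hi∈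
  where
    2+r≤hi : 2 + r ≤ hi
    2+r≤hi = ≤∧≢⇒< r<hi λ r+1≡hi → r+1∉ (subst (_∈ xs) (sym r+1≡hi) hi∈)
    lo≡r : lo ≡ r
    lo≡r = ≤-antisym lo≤r (+-cancelˡ-≤ 2 r lo (≤-trans 2+r≤hi hi≤2+lo))
    hi≡2+r : hi ≡ 2 + r
    hi≡2+r = ≤-antisym (≤-trans hi≤2+lo (+-monoʳ-≤ 2 lo≤r)) 2+r≤hi

leaves-via-next-two : ∀ {X Y p b} → Linked Near Y → p ∉ Y → All (_≤ p) X → Touching Near X Y →
                      b ∈ Y → p < b → suc p ∈ Y ⊎ 2 + p ∈ Y
leaves-via-next-two {Y = Y} {p} lY p∉ X≤p (x , y , x∈ , y∈ , _ , y≤2+x) b∈ p<b with <-cmp y p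
... | tri< (s≤s y≤r) _ _ = inj₁ (proj₂ (jumps-over lY p∉ y∈ b∈ y≤r p<b))
... | tri≈ _ refl _ = ⊥-elim (p∉ y∈)
... | tri> _ _ p<y with suc p ≟ y
...   | yes refl = inj₁ y∈
...   | no p+1≢y = inj₂ (subst (_∈ Y) y≡2+p y∈)
  where
    y≡2+p : y ≡ 2 + p
    y≡2+p = ≤-antisym (≤-trans y≤2+x (+-monoʳ-≤ 2 (All.lookup X≤p x∈))) (≤∧≢⇒< p<y p+1≢y)

above-next-two : ∀ {R p b z} → Linked Near R → p ∉ R → suc p ∉ R → 2 + p ∉ R →
                 b ∈ R → p < b → z ∈ R → 2 + p < z
above-next-two {p = p} {z = z} lR p∉ p+1∉ p+2∉ b∈ p<b z∈ with <-cmp z p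
... | tri< (s≤s z≤r) _ _ = ⊥-elim (p+1∉ (proj₂ (jumps-over lR p∉ z∈ b∈ z≤r p<b)))
... | tri≈ _ refl _ = ⊥-elim (p∉ z∈)
... | tri> _ _ p<z = ≤∧≢⇒< (≤∧≢⇒< p<z λ { refl → p+1∉ z∈ }) λ { refl → p+2∉ z∈ }

reaches-just-below : ∀ {X Y a r} → Linked Near X → suc r ∉ X → a ∈ X → a ≤ r →
                     Touching Near X Y → All (suc r <_) Y → r ∈ X
reaches-just-below {X} {r = r} lX r+1∉ a∈ a≤r (x , y , x∈ , y∈ , _ , y≤2+x) Y>r+1 with <-cmp x (suc r)
... | tri< x<r+1 _ _ = subst (_∈ X) (≤-antisym (≤-pred x<r+1) r≤x) x∈
  where
    r≤x : r ≤ x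
    r≤x = +-cancelˡ-≤ 2 r x (≤-trans (All.lookup Y>r+1 y∈) y≤2+x)
... | tri≈ _ refl _ = ⊥-elim (r+1∉ x∈)
... | tri> _ _ r+1<x = proj₁ (jumps-over lX r+1∉ a∈ x∈ a≤r r+1<x)

¬three-disjoint-meeting-two-points : ∀ {A : Set} {a b : A} (S : Fin 3 → List A) →
                                     (∀ {i j} → i ≢ j → Disjoint (S i) (S j)) →
                                     (∀ i → a ∈ S i ⊎ b ∈ S i) → ⊥
¬three-disjoint-meeting-two-points S disjoint meets with meets 0F | meets 1F | meets 2F
... | inj₁ a₀ | inj₁ a₁ | _ = disjoint {0F} {1F} (λ ()) (a₀ , a₁)
... | inj₂ b₀ | inj₂ b₁ | _ = disjoint {0F} {1F} (λ ()) (b₀ , b₁)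
... | inj₁ a₀ | _ | inj₁ a₂ = disjoint {0F} {2F} (λ ()) (a₀ , a₂)
... | inj₂ b₀ | _ | inj₂ b₂ = disjoint {0F} {2F} (λ ()) (b₀ , b₂)
... | _ | inj₁ a₁ | inj₁ a₂ = disjoint {1F} {2F} (λ ()) (a₁ , a₂)
... | _ | inj₂ b₁ | inj₂ b₂ = disjoint {1F} {2F} (λ ()) (b₁ , b₂)

module _ {s t : ℕ} (M : ListModel (Biclique (suc s) (suc t)) Near) where

  open ListModel M

  record FinishesFirst (u : Fin (suc s) ⊎ Fin (suc t)) (p : ℕ) : Set where
    field
      last∈  : p ∈ part u
      below  : All (_≤ p) (part u)
      beyond : ∀ {v} → v ≢ u → ∃ λ b → b ∈ part v × p < b

  part-nonempty : ∀ v → ∃ (_∈ part v)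
  part-nonempty (inj₁ i) = let (x , _ , x∈ , _) = touching (edge i 0F) in x , x∈
  part-nonempty (inj₂ j) = let (_ , y , _ , y∈ , _) = touching (edge 0F j) in y , y∈

  some-part-finishes-first : ∃₂ FinishesFirst
  some-part-finishes-first = u , top u , record { last∈ = top∈ u ; below = ≤top u ; beyond = beyond }
    where
      top : Fin (suc s) ⊎ Fin (suc t) → ℕ
      top v = proj₁ (greatest (proj₂ (part-nonempty v)))
      top∈ : ∀ v → top v ∈ part v
      top∈ v = proj₁ (proj₂ (greatest (proj₂ (part-nonempty v))))
      ≤top : ∀ v → All (_≤ top v) (part v)
      ≤top v = proj₂ (proj₂ (greatest (proj₂ (part-nonempty v))))
      vs : List (Fin (suc s) ⊎ Fin (suc t))
      vs = tabulate inj₁ ++ tabulate inj₂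
      ∈vs : ∀ v → v ∈ vs
      ∈vs (inj₁ i) = ∈-++⁺ˡ (∈-tabulate⁺ {f = inj₁} i)
      ∈vs (inj₂ j) = ∈-++⁺ʳ (tabulate inj₁) (∈-tabulate⁺ {f = inj₂} j)
      u : Fin (suc s) ⊎ Fin (suc t)
      u = argmin top (inj₁ 0F) vs
      u-least : ∀ v → top u ≤ top v
      u-least v = All.lookup (f[argmin]≤f[xs] {f = top} (inj₁ 0F) vs) (∈vs v)
      beyond : ∀ {v} → v ≢ u → ∃ λ b → b ∈ part v × top u < b
      beyond {v} v≢u = top v , top∈ v , ≤∧≢⇒< (u-least v) λ top-u≡top-v →
        ∉-other (top∈ v) v≢u (subst (_∈ part u) top-u≡top-v (top∈ u))

module _ (M : ListModel (Biclique 2 3) Near) where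

  open ListModel M

  hub-cannot-finish-first : ∀ {i p} → FinishesFirst M (inj₁ i) p → ⊥
  hub-cannot-finish-first {i} {p} first =
    ¬three-disjoint-meeting-two-points (part ∘ inj₂) (λ j≢k → disjoint (j≢k ∘ inj₂-injective))
                                       leg-next-two
    where
      open FinishesFirst first
      leg-next-two : ∀ j → suc p ∈ part (inj₂ j) ⊎ 2 + p ∈ part (inj₂ j)
      leg-next-two j with beyond {inj₂ j} (λ ())
      ... | b , b∈ , p<b =
        leaves-via-next-two (connected (inj₂ j)) (∉-other last∈ λ ()) below (touching (edge i j)) b∈ p<b

  module LegFinishesFirst {j p} (first : FinishesFirst M (inj₂ j) p) where

    open FinishesFirst first

    hubs-disjoint : Disjoint (part (inj₁ 0F)) (part (inj₁ 1F))
    hubs-disjoint = disjoint (λ ())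

    hub-next-two : ∀ h → suc p ∈ part (inj₁ h) ⊎ 2 + p ∈ part (inj₁ h)
    hub-next-two h with beyond {inj₁ h} (λ ())
    ... | b , b∈ , p<b = leaves-via-next-two (connected (inj₁ h)) (∉-other last∈ λ ()) below
                           (Touching-sym Near-sym (touching (edge h j))) b∈ p<b

    hub-low : ∀ h → ∃ λ a → a ∈ part (inj₁ h) × a ≤ 2 + p
    hub-low h = Sum.[ (λ p+1∈ → suc p , p+1∈ , n≤1+n _) , (λ p+2∈ → 2 + p , p+2∈ , ≤-refl) ]′
                    (hub-next-two h)

    next-two-in-hubs : (∃ λ h → suc p ∈ part (inj₁ h)) × (∃ λ h → 2 + p ∈ part (inj₁ h))
    next-two-in-hubs = sort (hub-next-two 0F) (hub-next-two 1F)
      where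
        sort : suc p ∈ part (inj₁ 0F) ⊎ 2 + p ∈ part (inj₁ 0F) →
               suc p ∈ part (inj₁ 1F) ⊎ 2 + p ∈ part (inj₁ 1F) →
               (∃ λ h → suc p ∈ part (inj₁ h)) × (∃ λ h → 2 + p ∈ part (inj₁ h))
        sort (inj₁ p+1∈₀) (inj₂ p+2∈₁) = (0F , p+1∈₀) , (1F , p+2∈₁)
        sort (inj₂ p+2∈₀) (inj₁ p+1∈₁) = (1F , p+1∈₁) , (0F , p+2∈₀)
        sort (inj₁ p+1∈₀) (inj₁ p+1∈₁) = ⊥-elim (hubs-disjoint (p+1∈₀ , p+1∈₁))
        sort (inj₂ p+2∈₀) (inj₂ p+2∈₁) = ⊥-elim (hubs-disjoint (p+2∈₀ , p+2∈₁))

    other-leg-high : ∀ {k z} → k ≢ j → z ∈ part (inj₂ k) → 2 + p < z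
    other-leg-high {k} k≢j z∈ =
      let (b , b∈ , p<b) = beyond {inj₂ k} (k≢j ∘ inj₂-injective)
          ((_ , p+1∈) , (_ , p+2∈)) = next-two-in-hubs
      in above-next-two (connected (inj₂ k)) (∉-other last∈ (k≢j ∘ sym ∘ inj₂-injective))
                        (∉-other p+1∈ λ ()) (∉-other p+2∈ λ ()) b∈ p<b z∈

    hubs-meet-below : ∀ {k k′ r} → 2 + p < r → r ∈ part (inj₂ k) →
                      All (r <_) (part (inj₂ k′)) → ⊥
    hubs-meet-below {k′ = k′} {suc r} (s≤s 2+p≤r) r+1∈ above =
      hubs-disjoint (reaches-r 0F , reaches-r 1F)
      where
        reaches-r : ∀ h → r ∈ part (inj₁ h)
        reaches-r h = let (a , a∈ , a≤2+p) = hub-low h in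
          reaches-just-below (connected (inj₁ h)) (∉-other r+1∈ λ ()) a∈ (≤-trans a≤2+p 2+p≤r)
                             (touching (edge h k′)) above

    no-leg-below-another : ∀ {k k′ r} → k ≢ j → r ∈ part (inj₂ k) →
                           All (r <_) (part (inj₂ k′)) → ⊥
    no-leg-below-another k≢j r∈ = hubs-meet-below (other-leg-high k≢j r∈) r∈

    k₁ k₂ : Fin 3
    k₁ = punchIn j 0F
    k₂ = punchIn j 1F

    k₁≢k₂ : k₁ ≢ k₂
    k₁≢k₂ eq = 0F≢1F (punchIn-injective j 0F 1F eq)
      where
        0F≢1F : 0F ≢ 1F
        0F≢1F ()

    compare-least : (∃ λ r → r ∈ part (inj₂ k₁) × All (r ≤_) (part (inj₂ k₁))) →
                    (∃ λ r → r ∈ part (inj₂ k₂) × All (r ≤_) (part (inj₂ k₂))) → ⊥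
    compare-least (r₁ , r₁∈ , r₁≤) (r₂ , r₂∈ , r₂≤) = case <-cmp r₁ r₂ of λ where
      (tri< r₁<r₂ _ _) →
        no-leg-below-another (punchInᵢ≢i j 0F) r₁∈ (All.map (<-≤-trans r₁<r₂) r₂≤)
      (tri≈ _ r₁≡r₂ _) →
        disjoint (k₁≢k₂ ∘ inj₂-injective) (r₁∈ , subst (_∈ _) (sym r₁≡r₂) r₂∈)
      (tri> _ _ r₂<r₁) →
        no-leg-below-another (punchInᵢ≢i j 1F) r₂∈ (All.map (<-≤-trans r₂<r₁) r₁≤)

    least-of-leg : ∀ k → ∃ λ r → r ∈ part (inj₂ k) × All (r ≤_) (part (inj₂ k))
    least-of-leg k = least (proj₂ (part-nonempty M (inj₂ k)))

    impossible : ⊥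
    impossible = compare-least (least-of-leg k₁) (least-of-leg k₂)

pathSquare-K₂,₃-free : ¬ ListModel (Biclique 2 3) Near
pathSquare-K₂,₃-free M = case some-part-finishes-first M of λ where
  (inj₁ _ , _ , first) → hub-cannot-finish-first M first
  (inj₂ _ , _ , first) → LegFinishesFirst.impossible M first

[m%n+k]%n≡[m+k]%n : ∀ m k n .{{_ : NonZero n}} → (m % n + k) % n ≡ (m + k) % n
[m%n+k]%n≡[m+k]%n m k n = begin
  (m % n + k) % n          ≡⟨ %-distribˡ-+ (m % n) k n ⟩
  (m % n % n + k % n) % n  ≡⟨ cong (λ x → (x + k % n) % n) (m%n%n≡m%n m n) ⟩
  (m % n + k % n) % n      ≡⟨ %-distribˡ-+ m k n ⟨
  (m + k) % n              ∎
  where open ≡-Reasoning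

C2-adj-sym : ∀ {n} {u v : Fin n} → C2-adj n u v → C2-adj n v u
C2-adj-sym {suc _} (inj₁ e) = inj₂ (inj₂ (inj₁ e))
C2-adj-sym {suc _} (inj₂ (inj₁ e)) = inj₂ (inj₂ (inj₂ e))
C2-adj-sym {suc _} (inj₂ (inj₂ (inj₁ e))) = inj₁ e
C2-adj-sym {suc _} (inj₂ (inj₂ (inj₂ e))) = inj₂ (inj₁ e)

-- Cutting the cycle open at base: vertexAt p lies p steps forward from base, and
-- position is its inverse on [0, N).
module Unrolling (m : ℕ) (base : Fin (suc m)) where

  private
    N b c : ℕ
    N = suc m
    b = toℕ base
    c = N ∸ b

    b+c≡N : b + c ≡ N
    b+c≡N = m+[n∸m]≡n (<⇒≤ (toℕ<n base))

  vertexAt : ℕ → Fin N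
  vertexAt p = fromℕ< (m%n<n (p + b) N)

  position : Fin N → ℕ
  position u = (toℕ u + c) % N

  toℕ-vertexAt : ∀ p → toℕ (vertexAt p) ≡ (p + b) % N
  toℕ-vertexAt p = toℕ-fromℕ< (m%n<n (p + b) N)

  position<N : ∀ u → position u < N
  position<N u = m%n<n (toℕ u + c) N

  position-vertexAt : ∀ {p} → p < N → position (vertexAt p) ≡ p
  position-vertexAt {p} p<N = begin
    (toℕ (vertexAt p) + c) % N  ≡⟨ cong (λ x → (x + c) % N) (toℕ-vertexAt p) ⟩
    ((p + b) % N + c) % N       ≡⟨ [m%n+k]%n≡[m+k]%n (p + b) c N ⟩
    (p + b + c) % N             ≡⟨ cong (_% N) (trans (+-assoc p b c) (cong (p +_) b+c≡N)) ⟩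
    (p + N) % N                 ≡⟨ [m+n]%n≡m%n p N ⟩
    p % N                       ≡⟨ m<n⇒m%n≡m p<N ⟩
    p                           ∎
    where open ≡-Reasoning

  vertexAt-position : ∀ u → vertexAt (position u) ≡ u
  vertexAt-position u = toℕ-injective (begin
    toℕ (vertexAt (position u))  ≡⟨ toℕ-vertexAt (position u) ⟩
    ((toℕ u + c) % N + b) % N    ≡⟨ [m%n+k]%n≡[m+k]%n (toℕ u + c) b N ⟩
    (toℕ u + c + b) % N          ≡⟨ cong (_% N) (trans (+-assoc (toℕ u) c b) (cong (toℕ u +_) c+b≡N)) ⟩
    (toℕ u + N) % N              ≡⟨ [m+n]%n≡m%n (toℕ u) N ⟩
    toℕ u % N                    ≡⟨ m<n⇒m%n≡m (toℕ<n u) ⟩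
    toℕ u                        ∎)
    where
      open ≡-Reasoning
      c+b≡N : c + b ≡ N
      c+b≡N = trans (+-comm c b) b+c≡N

  position-injective : ∀ {u v} → position u ≡ position v → u ≡ v
  position-injective {u} {v} eq = trans (sym (vertexAt-position u)) (trans (cong vertexAt eq) (vertexAt-position v))

  position≡⇒≡vertexAt : ∀ {u p} → position u ≡ p → u ≡ vertexAt p
  position≡⇒≡vertexAt {u} eq = trans (sym (vertexAt-position u)) (cong vertexAt eq)

  vertexAt-0 : vertexAt 0 ≡ base
  vertexAt-0 = toℕ-injective (trans (toℕ-vertexAt 0) (m<n⇒m%n≡m (toℕ<n base)))

  vertexAt-N : vertexAt N ≡ base
  vertexAt-N = toℕ-injective (begin
    toℕ (vertexAt N)  ≡⟨ toℕ-vertexAt N ⟩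
    (N + b) % N       ≡⟨ cong (_% N) (+-comm N b) ⟩
    (b + N) % N       ≡⟨ [m+n]%n≡m%n b N ⟩
    b % N             ≡⟨ m<n⇒m%n≡m (toℕ<n base) ⟩
    b                 ∎)
    where open ≡-Reasoning

  vertexAt-step : ∀ d p → (toℕ (vertexAt p) + d) % N ≡ toℕ (vertexAt (d + p))
  vertexAt-step d p = begin
    (toℕ (vertexAt p) + d) % N  ≡⟨ cong (λ x → (x + d) % N) (toℕ-vertexAt p) ⟩
    ((p + b) % N + d) % N       ≡⟨ [m%n+k]%n≡[m+k]%n (p + b) d N ⟩
    (p + b + d) % N             ≡⟨ cong (_% N) (trans (+-comm (p + b) d) (sym (+-assoc d p b))) ⟩
    (d + p + b) % N             ≡⟨ toℕ-vertexAt (d + p) ⟨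
    toℕ (vertexAt (d + p))      ∎
    where open ≡-Reasoning

  position-step : ∀ {u v} d → (toℕ u + d) % N ≡ toℕ v → position v ≡ (position u + d) % N
  position-step {u} {v} d shift = begin
    (toℕ v + c) % N            ≡⟨ cong (λ x → (x + c) % N) shift ⟨
    ((toℕ u + d) % N + c) % N  ≡⟨ [m%n+k]%n≡[m+k]%n (toℕ u + d) c N ⟩
    (toℕ u + d + c) % N        ≡⟨ cong (_% N) (+-swapʳ (toℕ u) d c) ⟩
    (toℕ u + c + d) % N        ≡⟨ [m%n+k]%n≡[m+k]%n (toℕ u + c) d N ⟨
    (position u + d) % N       ∎
    where
      open ≡-Reasoning
      +-swapʳ : ∀ x y z → x + y + z ≡ x + z + y
      +-swapʳ x y z = trans (+-assoc x y z) (trans (cong (x +_) (+-comm y z)) (sym (+-assoc x z y)))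

  no-wrap : ∀ {x d} → x < N → d ≤ 2 → 2 ≤ (x + d) % N → (x + d) % N ≡ x + d
  no-wrap {x} {d} x<N d≤2 2≤x+d%N with x + d <? N
  ... | yes x+d<N = m<n⇒m%n≡m x+d<N
  ... | no x+d≮N = ⊥-elim (<⇒≱ 2≤x+d%N wrapped≤1)
    where
      wrapped≤1 : (x + d) % N ≤ 1
      wrapped≤1 = begin
        (x + d) % N      ≡⟨ m≤n⇒[n∸m]%m≡n%m (≮⇒≥ x+d≮N) ⟨
        (x + d ∸ N) % N  ≤⟨ m%n≤m (x + d ∸ N) N ⟩
        x + d ∸ N        ≤⟨ ∸-monoˡ-≤ N (+-mono-≤ (≤-pred x<N) d≤2) ⟩
        m + 2 ∸ N        ≡⟨ cong (_∸ N) (+-suc m 1) ⟩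
        N + 1 ∸ N        ≡⟨ m+n∸m≡n N 1 ⟩
        1                ∎
        where open ≤-Reasoning

  forward-near : ∀ {u v} d → d ≤ 2 → (toℕ u + d) % N ≡ toℕ v → 2 ≤ position v →
                 Near (position u) (position v)
  forward-near {u} {v} d d≤2 shift 2≤pv = subst (Near (position u)) (sym pv≡pu+d)
    (≤-trans (m≤m+n (position u) d) (m≤n+m (position u + d) 2) ,
     ≤-trans (+-monoʳ-≤ (position u) d≤2) (≤-reflexive (+-comm (position u) 2)))
    where
      pv≡pu+d : position v ≡ position u + d
      pv≡pu+d = trans (position-step {u} {v} d shift)
                      (no-wrap (position<N u) d≤2 (subst (2 ≤_) (position-step {u} {v} d shift) 2≤pv))

  position-near : ∀ {u v} → 2 ≤ position u → 2 ≤ position v → C2-adj N u v →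
                  Near (position u) (position v)
  position-near {u} {v} _ 2≤pv (inj₁ u+1≡v) = forward-near {u} {v} 1 (s≤s z≤n) u+1≡v 2≤pv
  position-near {u} {v} _ 2≤pv (inj₂ (inj₁ u+2≡v)) = forward-near {u} {v} 2 ≤-refl u+2≡v 2≤pv
  position-near {u} {v} 2≤pu _ (inj₂ (inj₂ (inj₁ v+1≡u))) =
    Near-sym (forward-near {v} {u} 1 (s≤s z≤n) v+1≡u 2≤pu)
  position-near {u} {v} 2≤pu _ (inj₂ (inj₂ (inj₂ v+2≡u))) =
    Near-sym (forward-near {v} {u} 2 ≤-refl v+2≡u 2≤pu)

  2≤position : ∀ {u} → u ≢ vertexAt 0 → u ≢ vertexAt 1 → 2 ≤ position u
  2≤position {u} u≢v₀ u≢v₁ with position u in eq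
  ... | 0 = ⊥-elim (u≢v₀ (position≡⇒≡vertexAt eq))
  ... | 1 = ⊥-elim (u≢v₁ (position≡⇒≡vertexAt eq))
  ... | suc (suc _) = s≤s (s≤s z≤n)

  module _ (X : List (Fin N)) where

    open import Data.List.Membership.DecPropositional (Fin._≟_ {N}) using (_∈?_)

    private
      W : Fin N → Fin N → Set
      W = Walk (Csq N) (_∉ X)

    Gap : ℕ → ℕ → Set
    Gap s t = ∃ λ p → s < p × suc p < t × vertexAt p ∈ X × vertexAt (suc p) ∈ X

    Gap-widen : ∀ {s s′ t} → s ≤ s′ → Gap s′ t → Gap s t
    Gap-widen s≤s′ (p , s′<p , rest) = p , ≤-<-trans s≤s′ s′<p , rest

    blocked-after : ∀ d {s t} → 2 + d + s ≡ t →
                    vertexAt (1 + s) ∈ X → vertexAt (2 + s) ∈ X → vertexAt t ∉ X → Gap s t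
    blocked-after zero refl _ s+2∈ t∉ = ⊥-elim (t∉ s+2∈)
    blocked-after (suc d) {s} refl s+1∈ s+2∈ _ =
      1 + s , n<1+n s , s≤s (s≤s (s≤s (m≤n+m s d))) , s+1∈ , s+2∈

    step-forward : ∀ {s t} → vertexAt s ∉ X →
                   (vertexAt (1 + s) ∈ X → vertexAt (2 + s) ∈ X → Gap s t) →
                   Dec (vertexAt (1 + s) ∈ X) → Dec (vertexAt (2 + s) ∈ X) →
                   (vertexAt (1 + s) ∉ X → W (vertexAt (1 + s)) (vertexAt t) ⊎ Gap (1 + s) t) →
                   (vertexAt (2 + s) ∉ X → W (vertexAt (2 + s)) (vertexAt t) ⊎ Gap (2 + s) t) →
                   W (vertexAt s) (vertexAt t) ⊎ Gap s t
    step-forward {s} s∉ _ (no s+1∉) _ from-s+1 _ =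
      Sum.map (step s∉ (inj₁ (vertexAt-step 1 s))) (Gap-widen (n≤1+n s)) (from-s+1 s+1∉)
    step-forward {s} s∉ _ (yes _) (no s+2∉) _ from-s+2 =
      Sum.map (step s∉ (inj₂ (inj₁ (vertexAt-step 2 s)))) (Gap-widen (m≤n+m s 2)) (from-s+2 s+2∉)
    step-forward _ blocked (yes s+1∈) (yes s+2∈) _ _ = inj₂ (blocked s+1∈ s+2∈)

    walk-or-gap : ∀ d s {t} → d + s ≡ t → vertexAt s ∉ X → vertexAt t ∉ X →
                  W (vertexAt s) (vertexAt t) ⊎ Gap s t
    walk-or-gap zero s refl s∉ _ = inj₁ (here s∉)
    walk-or-gap (suc zero) s refl s∉ t∉ = inj₁ (step s∉ (inj₁ (vertexAt-step 1 s)) (here t∉))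
    walk-or-gap (suc (suc d)) s d+s≡t s∉ t∉ =
      step-forward s∉ (λ s+1∈ s+2∈ → blocked-after d d+s≡t s+1∈ s+2∈ t∉)
        (vertexAt (1 + s) ∈? X) (vertexAt (2 + s) ∈? X)
        (λ s+1∉ → walk-or-gap (suc d) (1 + s) (trans (+-suc (suc d) s) d+s≡t) s+1∉ t∉)
        (λ s+2∉ → walk-or-gap d (2 + s) (trans (+-suc² d s) d+s≡t) s+2∉ t∉)
      where
        +-suc² : ∀ d s → d + suc (suc s) ≡ suc (suc d) + s
        +-suc² d s = trans (+-suc d (suc s)) (cong suc (+-suc d s))

    two-gaps : ∀ {t} → Gap 0 t → Gap t N → 4 ≤ length X
    two-gaps (p , _ , p+1<t , p∈ , p+1∈) (q , t<q , q+1<N , q∈ , q+1∈) = begin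
      4                       ≤⟨ unique⊆⇒length≤ distinct gaps⊆positions ⟩
      length (map position X) ≡⟨ length-map position X ⟩
      length X                ∎
      where
        open ≤-Reasoning
        p+1<q : suc p < q
        p+1<q = <-trans p+1<t t<q
        q<N : q < N
        q<N = <-trans (n<1+n q) q+1<N
        p+1<N : suc p < N
        p+1<N = <-trans p+1<q q<N
        p<N : p < N
        p<N = <-trans (n<1+n p) p+1<N
        distinct : Unique (p ∷ suc p ∷ q ∷ suc q ∷ [])
        distinct = AllPairs.map <⇒≢ (Linked⇒AllPairs <-trans (n<1+n p ∷ p+1<q ∷ n<1+n q ∷ [-]))
        ∈positions : ∀ {r} → vertexAt r ∈ X → r < N → r ∈ map position X
        ∈positions v∈ r<N = subst (_∈ map position X) (position-vertexAt r<N) (∈-map⁺ position v∈)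
        gaps⊆positions : All (_∈ map position X) (p ∷ suc p ∷ q ∷ suc q ∷ [])
        gaps⊆positions = ∈positions p∈ p<N ∷ ∈positions p+1∈ p+1<N ∷
                         ∈positions q∈ q<N ∷ ∈positions q+1∈ q+1<N ∷ []

    walk-from-base : length X < 4 → base ∉ X → ∀ {y} → y ∉ X → W base y
    walk-from-base |X|<4 base∉ {y} y∉ =
      subst₂ W vertexAt-0 (vertexAt-position y)
        (around (walk-or-gap t 0 (+-identityʳ t) v₀∉ vₜ∉)
                (walk-or-gap (N ∸ t) t (m∸n+n≡m (<⇒≤ (position<N y))) vₜ∉ v_N∉))
      where
        t : ℕ
        t = position y
        v₀∉ : vertexAt 0 ∉ X
        v₀∉ = subst (_∉ X) (sym vertexAt-0) base∉
        vₜ∉ : vertexAt t ∉ X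
        vₜ∉ = subst (_∉ X) (sym (vertexAt-position y)) y∉
        v_N∉ : vertexAt N ∉ X
        v_N∉ = subst (_∉ X) (sym vertexAt-N) base∉
        around : W (vertexAt 0) (vertexAt t) ⊎ Gap 0 t → W (vertexAt t) (vertexAt N) ⊎ Gap t N →
                 W (vertexAt 0) (vertexAt t)
        around (inj₁ w) _ = w
        around (inj₂ _) (inj₁ w) = reverse C2-adj-sym (subst (W (vertexAt t)) (trans vertexAt-N (sym vertexAt-0)) w)
        around (inj₂ gap) (inj₂ gap′) = ⊥-elim (<⇒≱ |X|<4 (two-gaps gap gap′))

Csq-minus-three-connected : ∀ m (X : List (Fin (suc m))) → length X < 4 → ConnectedOn (Csq (suc m)) (_∉ X)
Csq-minus-three-connected m X |X|<4 x y x∉ y∉ = walk-from-base X |X|<4 x∉ y∉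
  where open Unrolling m x

-- Oct₂⁺ − w is K₃,₃ with sides {a, c, v''} and {b, d, v'}.
octVertex : Fin 3 ⊎ Fin 3 → Fin 7
octVertex (inj₁ 0F) = 1F
octVertex (inj₁ 1F) = 3F
octVertex (inj₁ 2F) = 6F
octVertex (inj₂ 0F) = 2F
octVertex (inj₂ 1F) = 4F
octVertex (inj₂ 2F) = 5F

octVertex⁻¹ : Fin 7 → Maybe (Fin 3 ⊎ Fin 3)
octVertex⁻¹ 0F = nothing
octVertex⁻¹ 1F = just (inj₁ 0F)
octVertex⁻¹ 2F = just (inj₂ 0F)
octVertex⁻¹ 3F = just (inj₁ 1F)
octVertex⁻¹ 4F = just (inj₂ 1F)
octVertex⁻¹ 5F = just (inj₂ 2F)
octVertex⁻¹ 6F = just (inj₁ 2F)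

octVertex⁻¹-octVertex : ∀ u → octVertex⁻¹ (octVertex u) ≡ just u
octVertex⁻¹-octVertex (inj₁ 0F) = refl
octVertex⁻¹-octVertex (inj₁ 1F) = refl
octVertex⁻¹-octVertex (inj₁ 2F) = refl
octVertex⁻¹-octVertex (inj₂ 0F) = refl
octVertex⁻¹-octVertex (inj₂ 1F) = refl
octVertex⁻¹-octVertex (inj₂ 2F) = refl

octVertex-injective : ∀ {u v} → octVertex u ≡ octVertex v → u ≡ v
octVertex-injective {u} {v} eq =
  just-injective (trans (sym (octVertex⁻¹-octVertex u))
                        (trans (cong octVertex⁻¹ eq) (octVertex⁻¹-octVertex v)))

octVertex≢0 : ∀ u → octVertex u ≢ 0F
octVertex≢0 u eq with trans (sym (octVertex⁻¹-octVertex u)) (cong octVertex⁻¹ eq)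
... | ()

octVertex-edge : ∀ i j → OctAdj (octVertex (inj₁ i)) (octVertex (inj₂ j))
octVertex-edge 0F 0F = inj₁ ab
octVertex-edge 0F 1F = inj₂ da
octVertex-edge 0F 2F = inj₂ v'a
octVertex-edge 1F 0F = inj₂ bc
octVertex-edge 1F 1F = inj₁ cd
octVertex-edge 1F 2F = inj₂ v'c
octVertex-edge 2F 0F = inj₁ v''b
octVertex-edge 2F 1F = inj₁ v''d
octVertex-edge 2F 2F = inj₂ v'v''

Csq-Oct2+-free : ∀ m → Free Oct2+ (Csq (suc m))
Csq-Oct2+-free m M =
  pathSquare-K₂,₃-free (mapModel position position-injective position-near K₂,₃ K₂,₃-beyond-1)
  where
    open MinorModel M using (Branch; nonempty; disjoint)
    open ListModel using (part)

    w₀ : Fin (suc m)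
    w₀ = proj₁ (nonempty 0F)

    open Unrolling m w₀

    K₃,₃ : ListModel (Biclique 3 3) (C2-adj (suc m))
    K₃,₃ = bicliqueModel M octVertex octVertex-injective octVertex-edge

    K₃,₃-misses-w₀ : ∀ w → vertexAt 0 ∉ part K₃,₃ w
    K₃,₃-misses-w₀ w v₀∈ = octVertex≢0 w (disjoint
      (All.lookup (bicliqueModel-in-branch M octVertex octVertex-injective octVertex-edge w) v₀∈)
      (subst (Branch 0F) (sym vertexAt-0) (proj₂ (nonempty 0F))))

    u₁ : Fin 3 ⊎ Fin 3
    u₁ = proj₁ (all-but-one-miss Fin._≟_ (vertexAt 1) K₃,₃)

    others-miss-vertexAt-1 : ∀ w → w ≢ u₁ → vertexAt 1 ∉ part K₃,₃ w
    others-miss-vertexAt-1 = proj₂ (all-but-one-miss Fin._≟_ (vertexAt 1) K₃,₃)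

    K₂,₃ : ListModel (Biclique 2 3) (C2-adj (suc m))
    K₂,₃ = deletePart C2-adj-sym u₁ K₃,₃

    K₂,₃-beyond-1 : ∀ v → All (λ x → 2 ≤ position x) (part K₂,₃ v)
    K₂,₃-beyond-1 = deletePart-All C2-adj-sym u₁ K₃,₃ λ w w≢u₁ → All.tabulate λ {x} x∈ →
      2≤position {x} (λ { refl → K₃,₃-misses-w₀ w x∈ })
                     (λ { refl → others-miss-vertexAt-1 w w≢u₁ x∈ })

lemma3p6 : (n : ℕ) → 5 ≤ n → KConnected 4 (Csq n) × Free Oct2+ (Csq n)
lemma3p6 (suc m) 5≤n = (5≤n , Csq-minus-three-connected m) , Csq-Oct2+-free m
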